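{- Let $G^p=(V^p,E^p)$ be a graph with $V^p=\{v_1,\dots,v_n\}$ and let $G=(V,E)$ be the graph constructed from it as described in the context. Then for any two distinct vertices $v_i,v_j\in V^p$: if $\{v_i,v_j\}\in E^p$ then $d_G(w_i,w_j)=2$, and if $\{v_i,v_j\}\notin E^p$ then $d_G(w_i,w_j)\ge 3$.
   Context: Construction: $V=\{w_i : v_i\in V^p\}\cup\{w_{i,j} : \{v_i,v_j\}\in E^p,\ i<j\}$. The edges of $E$ are: $\{w_i,w_{i,j}\}$ and $\{w_j,w_{i,j}\}$ for every vertex $w_{i,j}\in V$ (each edge-vertex is adjacent to the two vertices corresponding to its endpoints), and $\{w_{a,b},w_{c,d}\}$ for every two distinct edge-vertices $w_{a,b},w_{c,d}\in V$ whose corresponding edges $\{v_a,v_b\},\{v_c,v_d\}$ share an endpoint. There are no other edges (in particular no edges between two vertices $w_i,w_j$). $d_G(u,v)$ is the length of a shortest path between $u$ and $v$ in $G$. -}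

module Defs where

open import Data.Nat using (ℕ; zero; suc; _<_)
open import Data.Fin using (Fin) renaming (_<_ to _<ᶠ_)
open import Data.Product using (_×_)
open import Data.Sum using (_⊎_)
open import Relation.Nullary using (¬_)
open import Relation.Binary.PropositionalEquality using (_≡_)

record SimpleGraph (n : ℕ) : Set₁ where
  field
    Adj    : Fin n → Fin n → Set
    sym    : ∀ {i j} → Adj i j → Adj j i
    irrefl : ∀ {i} → ¬ Adj i i
    -- adjacency is a proposition (E^p is a set of edges, no multi-edges)
    prop   : ∀ {i j} (p q : Adj i j) → p ≡ q
open SimpleGraph public

-- Vertices of the constructed graph G:
--   w i        for every vertex v_i of G^p
--   w₂ i j     for every edge {v_i,v_j} of G^p with i < j
data CV {n : ℕ} (Gp : SimpleGraph n) : Set where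
  w  : Fin n → CV Gp
  w₂ : (i j : Fin n) → i <ᶠ j → Adj Gp i j → CV Gp

ShareEndpoint : ∀ {n} → Fin n → Fin n → Fin n → Fin n → Set
ShareEndpoint a b c d = (a ≡ c) ⊎ (a ≡ d) ⊎ (b ≡ c) ⊎ (b ≡ d)

data CAdj {n : ℕ} (Gp : SimpleGraph n) : CV Gp → CV Gp → Set where
  vert-edge : ∀ k i j p e → (k ≡ i) ⊎ (k ≡ j) → CAdj Gp (w k) (w₂ i j p e)
  edge-vert : ∀ k i j p e → (k ≡ i) ⊎ (k ≡ j) → CAdj Gp (w₂ i j p e) (w k)
  edge-edge : ∀ a b p e c d q f → ¬ (a ≡ c × b ≡ d) → ShareEndpoint a b c d
            → CAdj Gp (w₂ a b p e) (w₂ c d q f)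

data Walk {V : Set} (R : V → V → Set) : V → V → ℕ → Set where
  nil  : ∀ {u} → Walk R u u zero
  cons : ∀ {u v x k} → R u v → Walk R v x k → Walk R u x (suc k)

-- d_G(u,v) = k : there is a u–v walk of length k and none shorter
-- (the shortest walk length equals the shortest path length).
DistEq : {V : Set} (R : V → V → Set) → V → V → ℕ → Set
DistEq R u v k = Walk R u v k × (∀ m → m < k → ¬ Walk R u v m)

-- d_G(u,v) ≥ k : no u–v walk of length < k (includes d = ∞).
DistGe : {V : Set} (R : V → V → Set) → V → V → ℕ → Set
DistGe R u v k = ∀ m → m < k → ¬ Walk R u v m

module Submission where

-- In the constructed graph G, the vertices w i are pairwise non-adjacent, and the
-- common neighbours of w i and w j are exactly the edge-vertices of edges of G^p
-- containing both v_i and v_j.  Hence for distinct i, j: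
--   * there is no w i – w j walk of length 0 (i ≢ j) or 1 (no w–w edges);
--   * a walk of length 2 exists iff {v_i,v_j} ∈ E^p: it passes through the
--     edge-vertex of {v_i,v_j}, whose endpoints must then be i and j.

open import Defs
open import Data.Nat using (ℕ; zero; suc; s≤s)
open import Data.Nat.Properties using (m≤n⇒m<n∨m≡n)
open import Data.Fin using (Fin)
open import Data.Fin.Properties using (<-cmp)
open import Data.Product using (_×_; _,_)
open import Data.Sum using (_⊎_; inj₁; inj₂)
open import Relation.Nullary using (¬_; contradiction)
open import Relation.Binary using (tri<; tri≈; tri>)
open import Relation.Binary.PropositionalEquality using (_≡_; _≢_; refl)

distGe-suc : {V : Set} {R : V → V → Set} {u v : V} {k : ℕ} →
             DistGe R u v k → ¬ Walk R u v k → DistGe R u v (suc k)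
distGe-suc ge noWalk m (s≤s m≤k) with m≤n⇒m<n∨m≡n m≤k
... | inj₁ m<k  = ge m m<k
... | inj₂ refl = noWalk

module _ {n : ℕ} (Gp : SimpleGraph n) where

  no-vertex-vertex-edge : ∀ {i j : Fin n} → ¬ CAdj Gp (w i) (w j)
  no-vertex-vertex-edge ()

  distinct-distGe-2 : ∀ {i j : Fin n} → i ≢ j → DistGe (CAdj Gp) (w i) (w j) 2
  distinct-distGe-2 i≢j zero          _                 nil           = i≢j refl
  distinct-distGe-2 i≢j (suc zero)    _                 (cons r nil)  = no-vertex-vertex-edge r
  distinct-distGe-2 i≢j (suc (suc m)) (s≤s (s≤s ())) _

  -- A length-2 walk w i – w j passes through the edge-vertex of some edge
  -- {v_a,v_b} with i, j ∈ {a,b}; so either i = j or v_i v_j is an edge of G^p.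
  two-walk-gives-edge : ∀ {i j : Fin n} → Walk (CAdj Gp) (w i) (w j) 2 → i ≡ j ⊎ Adj Gp i j
  two-walk-gives-edge (cons (vert-edge _ a b _ e i∈ab) (cons (edge-vert _ _ _ _ _ j∈ab) nil)) =
    endpoints i∈ab j∈ab
    where
    endpoints : ∀ {i j} → i ≡ a ⊎ i ≡ b → j ≡ a ⊎ j ≡ b → i ≡ j ⊎ Adj Gp i j
    endpoints (inj₁ refl) (inj₁ refl) = inj₁ refl
    endpoints (inj₁ refl) (inj₂ refl) = inj₂ e
    endpoints (inj₂ refl) (inj₁ refl) = inj₂ (SimpleGraph.sym Gp e)
    endpoints (inj₂ refl) (inj₂ refl) = inj₁ refl

  -- Conversely, an edge {v_i,v_j} of G^p yields the walk w i – w_{i,j} – w j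
  -- (the edge-vertex is indexed by the endpoints in increasing order).
  edge-gives-two-walk : ∀ {i j : Fin n} → Adj Gp i j → Walk (CAdj Gp) (w i) (w j) 2
  edge-gives-two-walk {i} {j} e with <-cmp i j
  ... | tri< i<j _ _ = cons (vert-edge i i j i<j e (inj₁ refl)) (cons (edge-vert j i j i<j e (inj₂ refl)) nil)
  ... | tri≈ _ refl _ = contradiction e (SimpleGraph.irrefl Gp)
  ... | tri> _ _ j<i = cons (vert-edge i j i j<i e′ (inj₂ refl)) (cons (edge-vert j j i j<i e′ (inj₁ refl)) nil)
    where e′ = SimpleGraph.sym Gp e

lemma1 : ∀ (n : ℕ) (Gp : SimpleGraph n) (i j : Fin n) → i ≢ j →
    (Adj Gp i j → DistEq (CAdj Gp) (w i) (w j) 2)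
    × (¬ Adj Gp i j → DistGe (CAdj Gp) (w i) (w j) 3)
lemma1 n Gp i j i≢j = adjacent , non-adjacent
  where
  adjacent : Adj Gp i j → DistEq (CAdj Gp) (w i) (w j) 2
  adjacent e = edge-gives-two-walk Gp e , distinct-distGe-2 Gp i≢j

  no-two-walk : ¬ Adj Gp i j → ¬ Walk (CAdj Gp) (w i) (w j) 2
  no-two-walk ¬e walk with two-walk-gives-edge Gp walk
  ... | inj₁ i≡j = i≢j i≡j
  ... | inj₂ e   = ¬e e

  non-adjacent : ¬ Adj Gp i j → DistGe (CAdj Gp) (w i) (w j) 3
  non-adjacent ¬e = distGe-suc (distinct-distGe-2 Gp i≢j) (no-two-walk ¬e)
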